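{- There is an infinite family of strings $S$ over the binary alphabet $\{\mathtt{1},\mathtt{2}\}$ such that, with $n = |S|$, $\mathsf{CPH}(S)$ has a node with $\Omega(\sqrt{n})$ outgoing edges.
   Context: $\mathsf{PD}(X)[i] = i - \max\{j<i : X[j]\le X[i]\}$ if such $j$ exists and $0$ otherwise; $S[i..]=S[i..|S|]$. Sequence hash tree $\mathsf{SHT}(\langle w_1,\ldots,w_k\rangle)$: the trie (nodes identified with path labels) built from a root by adding, for $i=1,\ldots,k$, the node $w_i[1..|p_i|+1]$ as a child (edge label $w_i[|p_i|+1]$) of the longest prefix $p_i$ of $w_i$ already present. For $|S|=n$, $\mathsf{CPH}(S) = \mathsf{SHT}(\langle \mathsf{PD}(S[n..]),\ldots,\mathsf{PD}(S[1..])\rangle)$. -}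

module Defs where

open import Data.Nat using (ℕ; zero; suc; _≤ᵇ_; _<ᵇ_)
open import Data.Bool using (Bool; true; false; if_then_else_)
open import Data.List using (List; []; _∷_; _++_; [_]; length; map; foldl; reverse; filter; inits; take; last)
open import Data.List.Properties using (≡-dec)
open import Data.Maybe using (fromMaybe)
open import Data.Nat.Properties using () renaming (_≟_ to _≟ℕ_)
open import Data.List.Membership.DecPropositional (≡-dec _≟ℕ_) using (_∈?_)
open import Data.Sum using (_⊎_)
open import Relation.Binary.PropositionalEquality using (_≡_)

Binary : ℕ → Set
Binary a = (a ≡ 1) ⊎ (a ≡ 2)

-- dist seen x k : `seen` is the already-read prefix in reverse order
-- (nearest position first); returns the distance to the nearest earlier
-- position j with X[j] ≤ x, or 0 if none exists.
dist : List ℕ → ℕ → ℕ → ℕ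
dist []       x k = 0
dist (y ∷ ys) x k = if y ≤ᵇ x then k else dist ys x (suc k)

pdAux : List ℕ → List ℕ → List ℕ
pdAux seen []       = []
pdAux seen (x ∷ xs) = dist seen x 1 ∷ pdAux (x ∷ seen) xs

PD : List ℕ → List ℕ
PD = pdAux []

suffixes : List ℕ → List (List ℕ)
suffixes []       = []
suffixes (x ∷ xs) = (x ∷ xs) ∷ suffixes xs

-- A trie is represented by its set of nodes (identified with path labels).
Trie : Set
Trie = List (List ℕ)

shtInsert : Trie → List ℕ → Trie
shtInsert T w =
  let p = fromMaybe [] (last (filter (_∈? T) (inits w))) in
  if length p <ᵇ length w then T ++ [ take (suc (length p)) w ] else T

SHT : List (List ℕ) → Trie
SHT ws = foldl shtInsert [ [] ] ws

CPH : List ℕ → Trie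
CPH S = SHT (map PD (reverse (suffixes S)))

-- Take S = 1^(k+1) 2^0 1^k 2^1 ⋯ 1^1 2^k · 1 · 2^(k+1), of length (k+1)² + k + 2.
-- The suffixes 2^(j+1) are inserted first and lay down the path 0 1^j, j ≤ k.
-- The suffix starting at the block 1^(k+1-t) 2^t has PD = 0 1^k (t+1) ⋯, because
-- the nearest symbol ≤ 1 before the block's closing 1 lies t+1 positions back;
-- as 0 1^k is already a node, inserting it adds the child t+1.  So the node 0 1^k
-- has k+1 distinct children.
module Submission where

open import Defs
open import Data.Bool using (true; false; if_then_else_)
open import Data.List
  using (List; []; _∷_; _++_; [_]; length; map; foldl; reverse; filter; inits; take; last; replicate; upTo)
open import Data.List.Properties
  using (≡-dec; ++-assoc; take-take; filter-accept; filter-++; map-++; map-∘; foldl-++;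
         unfold-reverse; length-++; length-replicate; length-map; length-upTo)
open import Data.List.Membership.Propositional using (_∈_)
open import Data.List.Membership.Propositional.Properties
  using (∈-++⁺ˡ; ∈-++⁺ʳ; ∈-++⁻; ∈-map⁻; ∈-filter⁻)
open import Data.List.Relation.Unary.Any using (here; there)
open import Data.List.Relation.Unary.All as All using (All; []; _∷_)
open import Data.List.Relation.Unary.All.Properties using (++⁺; replicate⁺; all-upTo) renaming (map⁺ to All-map⁺)
open import Data.List.Relation.Unary.Unique.Propositional using (Unique)
open import Data.List.Relation.Unary.Unique.Propositional.Properties using (upTo⁺) renaming (map⁺ to Unique-map⁺)
open import Data.Maybe using (fromMaybe)
open import Data.Nat using (ℕ; zero; suc; _+_; _*_; _∸_; _≤_; _<_; _<ᵇ_; z≤n; s≤s)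
open import Data.Nat.Properties
open import Data.Product using (∃-syntax; _×_; _,_; proj₁; proj₂)
open import Data.Sum using (inj₁; inj₂)
open import Relation.Binary.PropositionalEquality
  using (_≡_; refl; sym; trans; cong; cong₂; subst; module ≡-Reasoning)
open import Relation.Nullary using (yes; no)
open import Data.List.Membership.DecPropositional (≡-dec _≟_) using (_∈?_)

variable
  A : Set

take-take-≤ : ∀ {n m} (xs : List A) → n ≤ m → take n (take m xs) ≡ take n xs
take-take-≤ {n = n} {m = m} xs n≤m = trans (take-take n m xs) (cong (λ k → take k xs) (m≤n⇒m⊓n≡m n≤m))

take-take-≥ : ∀ {n m} (xs : List A) → m ≤ n → take n (take m xs) ≡ take m xs
take-take-≥ {n = n} {m = m} xs m≤n = trans (take-take n m xs) (cong (λ k → take k xs) (m≥n⇒m⊓n≡n m≤n))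

take-suc-length-++ : ∀ (p : List A) a r → take (suc (length p)) (p ++ a ∷ r) ≡ p ++ [ a ]
take-suc-length-++ []      a r = refl
take-suc-length-++ (x ∷ p) a r = cong (x ∷_) (take-suc-length-++ p a r)

length-<ᵇ-++-∷ : ∀ (p : List A) a r → (length p <ᵇ length (p ++ a ∷ r)) ≡ true
length-<ᵇ-++-∷ []      a r = refl
length-<ᵇ-++-∷ (x ∷ p) a r = length-<ᵇ-++-∷ p a r

replicate-+ : ∀ m n (x : A) → replicate (m + n) x ≡ replicate m x ++ replicate n x
replicate-+ zero    n x = refl
replicate-+ (suc m) n x = cong (x ∷_) (replicate-+ m n x)

replicate-∷ʳ : ∀ n (x : A) → replicate n x ++ [ x ] ≡ x ∷ replicate n x
replicate-∷ʳ zero    x = refl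
replicate-∷ʳ (suc n) x = cong (x ∷_) (replicate-∷ʳ n x)

last-++-∷ : ∀ (xs : List A) y ys → last (xs ++ y ∷ ys) ≡ last (y ∷ ys)
last-++-∷ []           y ys = refl
last-++-∷ (x ∷ [])     y ys = refl
last-++-∷ (x ∷ x′ ∷ xs) y ys = last-++-∷ (x′ ∷ xs) y ys

fromMaybe-last-∈ : ∀ d (y : A) ys → fromMaybe d (last (y ∷ ys)) ∈ y ∷ ys
fromMaybe-last-∈ d y []        = here refl
fromMaybe-last-∈ d y (y′ ∷ ys) = there (fromMaybe-last-∈ d y′ ys)

∈-inits : ∀ {z} (w : List A) → z ∈ inits w → z ≡ take (length z) w
∈-inits []      (here refl) = refl
∈-inits (x ∷ w) (here refl) = refl
∈-inits (x ∷ w) (there z∈) with ∈-map⁻ (x ∷_) z∈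
... | z′ , z′∈ , refl = cong (x ∷_) (∈-inits w z′∈)

inits-++-∷ : ∀ (p : List A) a r →
  ∃[ ys ] inits (p ++ a ∷ r) ≡ ys ++ p ∷ map (λ s → p ++ a ∷ s) (inits r)
inits-++-∷ []      a r = [] , refl
inits-++-∷ (x ∷ p) a r with inits-++-∷ p a r
... | ys , eq = [] ∷ map (x ∷_) ys , cong ([] ∷_) (begin
    map (x ∷_) (inits (p ++ a ∷ r))
  ≡⟨ cong (map (x ∷_)) eq ⟩
    map (x ∷_) (ys ++ p ∷ map (λ s → p ++ a ∷ s) (inits r))
  ≡⟨ map-++ (x ∷_) ys _ ⟩
    map (x ∷_) ys ++ (x ∷ p) ∷ map (x ∷_) (map (λ s → p ++ a ∷ s) (inits r))
  ≡⟨ cong (λ l → map (x ∷_) ys ++ (x ∷ p) ∷ l) (sym (map-∘ (inits r))) ⟩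
    map (x ∷_) ys ++ (x ∷ p) ∷ map (λ s → x ∷ p ++ a ∷ s) (inits r) ∎)
  where open ≡-Reasoning

suffixes-++⁺ : ∀ {ys zs} (xs : List ℕ) → ys ∈ suffixes zs → ys ∈ suffixes (xs ++ zs)
suffixes-++⁺ []       ys∈ = ys∈
suffixes-++⁺ (x ∷ xs) ys∈ = there (suffixes-++⁺ xs ys∈)

suffixes-trans : ∀ {xs ys zs} → xs ∈ suffixes ys → ys ∈ suffixes zs → xs ∈ suffixes zs
suffixes-trans {zs = z ∷ zs} xs∈ (here refl) = xs∈
suffixes-trans {zs = z ∷ zs} xs∈ (there ys∈) = there (suffixes-trans xs∈ ys∈)

PrefixClosed : Trie → Set
PrefixClosed T = ∀ {q} → q ∈ T → ∀ n → take n q ∈ T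

IsTrie : Trie → Set
IsTrie T = [] ∈ T × PrefixClosed T

-- shtInsert T w unfolds definitionally to addChild T w (longestPrefix T w).

longestPrefix : Trie → List ℕ → List ℕ
longestPrefix T w = fromMaybe [] (last (filter (_∈? T) (inits w)))

addChild : Trie → List ℕ → List ℕ → Trie
addChild T w p = if length p <ᵇ length w then T ++ [ take (suc (length p)) w ] else T

addChild-mono : ∀ {T q} w p → q ∈ T → q ∈ addChild T w p
addChild-mono w p q∈T with length p <ᵇ length w
... | true  = ∈-++⁺ˡ q∈T
... | false = q∈T

addChild-isTrie : ∀ {T p} w → IsTrie T → p ∈ T → p ≡ take (length p) w → IsTrie (addChild T w p)
addChild-isTrie {T} {p} w (root , closed) p∈T p⊑w with length p <ᵇ length w
... | false = root , closed
... | true  = ∈-++⁺ˡ root , closed′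
  where
  closed′ : PrefixClosed (T ++ [ take (suc (length p)) w ])
  closed′ q∈ n with ∈-++⁻ T q∈
  ... | inj₁ q∈T = ∈-++⁺ˡ (closed q∈T n)
  ... | inj₂ (here refl) with n ≤? length p
  ...   | no n≰ = ∈-++⁺ʳ T (here (take-take-≥ w (≰⇒> n≰)))
  ...   | yes n≤ = ∈-++⁺ˡ (subst (_∈ T) take-p (closed p∈T n))
    where
    open ≡-Reasoning
    take-p : take n p ≡ take n (take (suc (length p)) w)
    take-p = begin
      take n p                         ≡⟨ cong (take n) p⊑w ⟩
      take n (take (length p) w)       ≡⟨ take-take-≤ w n≤ ⟩
      take n w                         ≡⟨ take-take-≤ w (m≤n⇒m≤1+n n≤) ⟨
      take n (take (suc (length p)) w) ∎

addChild-new : ∀ T p a r → (p ++ [ a ]) ∈ addChild T (p ++ a ∷ r) p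
addChild-new T p a r rewrite length-<ᵇ-++-∷ p a r = ∈-++⁺ʳ T (here (sym (take-suc-length-++ p a r)))

longestPrefix-∈ : ∀ {T} w → [] ∈ T → longestPrefix T w ∈ inits w × longestPrefix T w ∈ T
longestPrefix-∈ {T} w root =
  ∈-filter⁻ (_∈? T) (subst (λ l → fromMaybe [] (last l) ∈ l) (sym accept) (fromMaybe-last-∈ [] [] _))
  where accept = filter-accept (_∈? T) {[]} {Data.List.Inits.tail w} root

last-filter-∈ : ∀ {T} xs y ys → y ∈ T → fromMaybe [] (last (filter (_∈? T) (xs ++ y ∷ ys))) ∈ y ∷ ys
last-filter-∈ {T} xs y ys y∈T
  rewrite filter-++ (_∈? T) xs (y ∷ ys) | filter-accept (_∈? T) {y} {ys} y∈T
        | last-++-∷ (filter (_∈? T) xs) y (filter (_∈? T) ys)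
  with fromMaybe-last-∈ [] y (filter (_∈? T) ys)
... | here eq = here eq
... | there z∈ = there (proj₁ (∈-filter⁻ (_∈? T) z∈))

longestPrefix-++-∷ : ∀ {T p} a r → p ∈ T →
  longestPrefix T (p ++ a ∷ r) ∈ p ∷ map (λ s → p ++ a ∷ s) (inits r)
longestPrefix-++-∷ {T} {p} a r p∈T with inits-++-∷ p a r
... | ys , eq = subst (λ l → fromMaybe [] (last (filter (_∈? T) l)) ∈ _) (sym eq) (last-filter-∈ ys p _ p∈T)

shtInsert-mono : ∀ {T q} w → q ∈ T → q ∈ shtInsert T w
shtInsert-mono {T} w = addChild-mono w (longestPrefix T w)

shtInsert-isTrie : ∀ {T} w → IsTrie T → IsTrie (shtInsert T w)
shtInsert-isTrie {T} w trie@(root , _) =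
  addChild-isTrie w trie (proj₂ lp∈) (∈-inits w (proj₁ lp∈))
  where lp∈ = longestPrefix-∈ w root

-- The longest prefix already present is either p itself, which gets the child a,
-- or a proper extension p ++ a ∷ s, whose prefix p ++ [ a ] is present by closedness.
shtInsert-child : ∀ {T p} a r → IsTrie T → p ∈ T → (p ++ [ a ]) ∈ shtInsert T (p ++ a ∷ r)
shtInsert-child {T} {p} a r (root , closed) p∈T
  with longestPrefix T (p ++ a ∷ r) | longestPrefix-∈ {T} (p ++ a ∷ r) root | longestPrefix-++-∷ a r p∈T
... | .p | _ | here refl = addChild-new T p a r
... | lp | _ , lp∈T | there lp∈ with ∈-map⁻ (λ s → p ++ a ∷ s) lp∈
...   | s , _ , refl = addChild-mono (p ++ a ∷ r) lp
        (subst (_∈ T) (take-suc-length-++ p a s) (closed lp∈T (suc (length p))))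

CPH-∷ : ∀ x xs → CPH (x ∷ xs) ≡ shtInsert (CPH xs) (PD (x ∷ xs))
CPH-∷ x xs = begin
    foldl shtInsert [ [] ] (map PD (reverse ((x ∷ xs) ∷ suffixes xs)))
  ≡⟨ cong (λ l → foldl shtInsert [ [] ] (map PD l)) (unfold-reverse (x ∷ xs) (suffixes xs)) ⟩
    foldl shtInsert [ [] ] (map PD (reverse (suffixes xs) ++ [ x ∷ xs ]))
  ≡⟨ cong (foldl shtInsert [ [] ]) (map-++ PD (reverse (suffixes xs)) [ x ∷ xs ]) ⟩
    foldl shtInsert [ [] ] (map PD (reverse (suffixes xs)) ++ [ PD (x ∷ xs) ])
  ≡⟨ foldl-++ shtInsert [ [] ] (map PD (reverse (suffixes xs))) [ PD (x ∷ xs) ] ⟩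
    shtInsert (CPH xs) (PD (x ∷ xs)) ∎
  where open ≡-Reasoning

CPH-isTrie : ∀ S → IsTrie (CPH S)
CPH-isTrie []       = here refl , λ { (here refl) zero → here refl ; (here refl) (suc n) → here refl }
CPH-isTrie (x ∷ xs) = subst IsTrie (sym (CPH-∷ x xs)) (shtInsert-isTrie (PD (x ∷ xs)) (CPH-isTrie xs))

CPH-suffix-mono : ∀ {q ys} xs → ys ∈ suffixes xs → q ∈ CPH ys → q ∈ CPH xs
CPH-suffix-mono (x ∷ xs) (here refl) q∈ = q∈
CPH-suffix-mono (x ∷ xs) (there ys∈) q∈ =
  subst (_ ∈_) (sym (CPH-∷ x xs)) (shtInsert-mono (PD (x ∷ xs)) (CPH-suffix-mono xs ys∈ q∈))

CPH-child : ∀ {p} x xs a r → p ∈ CPH xs → PD (x ∷ xs) ≡ p ++ a ∷ r → (p ++ [ a ]) ∈ CPH (x ∷ xs)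
CPH-child {p} x xs a r p∈ pd =
  subst (_ ∈_) (sym (CPH-∷ x xs))
    (subst (λ w → (p ++ [ a ]) ∈ shtInsert (CPH xs) w) (sym pd) (shtInsert-child a r (CPH-isTrie xs) p∈))

pdAux-ones : ∀ i s r → ∃[ s′ ] pdAux (1 ∷ s) (replicate i 1 ++ r) ≡ replicate i 1 ++ pdAux (1 ∷ s′) r
pdAux-ones zero    s r = s , refl
pdAux-ones (suc i) s r with pdAux-ones i (1 ∷ s) r
... | s′ , eq = s′ , cong (1 ∷_) eq

pdAux-twos : ∀ t s → pdAux (2 ∷ s) (replicate t 2) ≡ replicate t 1
pdAux-twos zero    s = refl
pdAux-twos (suc t) s = cong (1 ∷_) (pdAux-twos t (2 ∷ s))

dist-twos-one : ∀ j s k → dist (replicate j 2 ++ 1 ∷ s) 1 (suc k) ≡ suc (j + k)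
dist-twos-one zero    s k = refl
dist-twos-one (suc j) s k = trans (dist-twos-one j s (suc k)) (cong suc (+-suc j k))

dist-twos-two : ∀ j s → dist (replicate j 2 ++ 1 ∷ s) 2 1 ≡ 1
dist-twos-two zero    s = refl
dist-twos-two (suc j) s = refl

-- j counts the 2s already read since the last 1.
pdAux-twos-one : ∀ t j s r →
  ∃[ R ] pdAux (replicate j 2 ++ 1 ∷ s) (replicate t 2 ++ 1 ∷ r) ≡ replicate t 1 ++ suc (j + t) ∷ R
pdAux-twos-one zero    j s r = _ , cong (_∷ pdAux (1 ∷ replicate j 2 ++ 1 ∷ s) r) (dist-twos-one j s 0)
pdAux-twos-one (suc t) j s r with pdAux-twos-one t (suc j) s r
... | R , eq = R , cong₂ _∷_ (dist-twos-two j s) (trans eq (cong (λ n → replicate t 1 ++ suc n ∷ R) (sym (+-suc j t))))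

spine : ℕ → List ℕ
spine m = 0 ∷ replicate m 1

PD-twos : ∀ m → PD (replicate (suc m) 2) ≡ spine m
PD-twos m = cong (0 ∷_) (pdAux-twos m [])

PD-block : ∀ i t r → ∃[ R ] PD (1 ∷ replicate i 1 ++ replicate t 2 ++ 1 ∷ r) ≡ spine (i + t) ++ suc t ∷ R
PD-block i t r with pdAux-ones i [] (replicate t 2 ++ 1 ∷ r)
... | s , ones with pdAux-twos-one t 0 s r
... | R , twos = R , cong (0 ∷_) (begin
    pdAux [ 1 ] (replicate i 1 ++ replicate t 2 ++ 1 ∷ r)  ≡⟨ ones ⟩
    replicate i 1 ++ pdAux (1 ∷ s) (replicate t 2 ++ 1 ∷ r) ≡⟨ cong (replicate i 1 ++_) twos ⟩
    replicate i 1 ++ replicate t 1 ++ suc t ∷ R              ≡⟨ ++-assoc (replicate i 1) _ _ ⟨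
    (replicate i 1 ++ replicate t 1) ++ suc t ∷ R            ≡⟨ cong (_++ suc t ∷ R) (replicate-+ i t 1) ⟨
    replicate (i + t) 1 ++ suc t ∷ R                         ∎)
  where open ≡-Reasoning

-- stair i t rest = 1^i 2^t 1^(i-1) 2^(t+1) ⋯ 1^1 2^(t+i-1) · 1 · rest
stair : ℕ → ℕ → List ℕ → List ℕ
stair zero    t rest = 1 ∷ rest
stair (suc i) t rest = replicate (suc i) 1 ++ replicate t 2 ++ stair i (suc t) rest

PD-stair : ∀ i t rest → ∃[ R ] PD (stair (suc i) t rest) ≡ spine (i + t) ++ suc t ∷ R
PD-stair zero    t rest = PD-block 0 t rest
PD-stair (suc i) t rest = PD-block (suc i) t (replicate i 1 ++ replicate (suc t) 2 ++ stair i (suc (suc t)) rest)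

stair-suffix : ∀ i t rest → stair (suc i) t rest ∈ suffixes (stair (suc (i + t)) 0 rest)
stair-suffix i zero rest =
  subst (λ n → stair (suc i) 0 rest ∈ suffixes (stair (suc n) 0 rest)) (sym (+-identityʳ i)) (here refl)
stair-suffix i (suc t) rest =
  subst (λ n → stair (suc i) (suc t) rest ∈ suffixes (stair (suc n) 0 rest)) (sym (+-suc i t))
    (suffixes-trans next-block (stair-suffix (suc i) t rest))
  where
  next-block : stair (suc i) (suc t) rest ∈ suffixes (stair (suc (suc i)) t rest)
  next-block = suffixes-++⁺ (replicate (suc (suc i)) 1) (suffixes-++⁺ (replicate t 2) (here refl))

stair-rest-suffix : ∀ i t x xs → (x ∷ xs) ∈ suffixes (stair i t (x ∷ xs))
stair-rest-suffix zero    t x xs = there (here refl)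
stair-rest-suffix (suc i) t x xs =
  suffixes-++⁺ (replicate (suc i) 1) (suffixes-++⁺ (replicate t 2) (stair-rest-suffix i (suc t) x xs))

length-stair : ∀ {K} i t rest → i + t ≡ K → length (stair i t rest) ≡ i * K + suc (length rest)
length-stair zero t rest eq = refl
length-stair {K} (suc i) t rest eq = begin
    length (replicate (suc i) 1 ++ replicate t 2 ++ stair i (suc t) rest)
  ≡⟨ length-++ (replicate (suc i) 1) ⟩
    length (replicate (suc i) 1) + length (replicate t 2 ++ stair i (suc t) rest)
  ≡⟨ cong₂ _+_ (length-replicate (suc i)) (length-++ (replicate t 2)) ⟩
    suc i + (length (replicate t 2) + length (stair i (suc t) rest))
  ≡⟨ cong₂ (λ a b → suc i + (a + b)) (length-replicate t) (length-stair i (suc t) rest (trans (+-suc i t) eq)) ⟩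
    suc i + (t + (i * K + suc (length rest)))
  ≡⟨ +-assoc (suc i) t _ ⟨
    (suc i + t) + (i * K + suc (length rest))
  ≡⟨ cong (_+ (i * K + suc (length rest))) eq ⟩
    K + (i * K + suc (length rest))
  ≡⟨ +-assoc K (i * K) _ ⟨
    suc i * K + suc (length rest) ∎
  where open ≡-Reasoning

stair-binary : ∀ i t {rest} → All Binary rest → All Binary (stair i t rest)
stair-binary zero    t bin = inj₁ refl ∷ bin
stair-binary (suc i) t bin =
  ++⁺ (replicate⁺ (suc i) (inj₁ refl)) (++⁺ (replicate⁺ t (inj₂ refl)) (stair-binary i (suc t) bin))

spine-∈-CPH-twos : ∀ m → spine m ∈ CPH (replicate (suc m) 2)
spine-∈-CPH-twos zero    = CPH-child 2 [] 0 [] (here refl) refl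
spine-∈-CPH-twos (suc m) =
  subst (_∈ CPH (replicate (suc (suc m)) 2)) (cong (0 ∷_) (replicate-∷ʳ m 1))
    (CPH-child 2 (replicate (suc m) 2) 1 [] (spine-∈-CPH-twos m)
      (trans (PD-twos (suc m)) (cong (0 ∷_) (sym (replicate-∷ʳ m 1)))))

witness : ℕ → List ℕ
witness k = stair (suc k) 0 (replicate (suc k) 2)

spine-∈-CPH-witness : ∀ k → spine k ∈ CPH (witness k)
spine-∈-CPH-witness k =
  CPH-suffix-mono (witness k) (stair-rest-suffix (suc k) 0 2 (replicate k 2)) (spine-∈-CPH-twos k)

spine-child-∈-CPH-witness : ∀ i t → (spine (i + t) ++ [ suc t ]) ∈ CPH (witness (i + t))
spine-child-∈-CPH-witness i t with PD-stair i t (replicate (suc (i + t)) 2)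
... | R , pd = CPH-suffix-mono (witness (i + t)) (stair-suffix i t _)
                 (CPH-child 1 _ (suc t) R spine∈ pd)
  where
  spine∈ : spine (i + t) ∈ CPH (replicate i 1 ++ replicate t 2 ++ stair i (suc t) (replicate (suc (i + t)) 2))
  spine∈ = CPH-suffix-mono _
    (suffixes-++⁺ (replicate i 1) (suffixes-++⁺ (replicate t 2) (stair-rest-suffix i (suc t) 2 (replicate (i + t) 2))))
    (spine-∈-CPH-twos (i + t))

spine-children : ∀ k → All (λ a → (spine k ++ [ a ]) ∈ CPH (witness k)) (map suc (upTo (suc k)))
spine-children k = All-map⁺ (All.map child (all-upTo (suc k)))
  where
  child : ∀ {t} → t < suc k → (spine k ++ [ suc t ]) ∈ CPH (witness k)
  child {t} t<sk = subst (λ n → (spine n ++ [ suc t ]) ∈ CPH (witness n)) (m∸n+n≡m (≤-pred t<sk))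
                     (spine-child-∈-CPH-witness (k ∸ t) t)

length-witness : ∀ k → length (witness k) ≡ suc k * suc k + suc (suc k)
length-witness k =
  trans (length-stair (suc k) 0 (replicate (suc k) 2) (+-identityʳ (suc k)))
        (cong (λ n → suc k * suc k + suc n) (length-replicate (suc k)))

length-witness-≥ : ∀ k → k ≤ length (witness k)
length-witness-≥ k rewrite length-witness k = ≤-trans (m≤n+m k 2) (m≤n+m (2 + k) (suc k * suc k))

length-witness-≤ : ∀ k → length (witness k) ≤ 3 * (suc k * suc k)
length-witness-≤ k rewrite length-witness k =
  +-monoʳ-≤ (s * s) (+-mono-≤ (s≤s z≤n) (≤-trans (m≤m*n s s) (m≤m+n (s * s) 0)))
  where s = suc k

lemma7 : ∃[ c ] (0 < c × (∀ (m : ℕ) → ∃[ S ] (All Binary S × m ≤ length S × ∃[ u ] (u ∈ CPH S × ∃[ L ] (Unique L × All (λ a → (u ++ [ a ]) ∈ CPH S) L × length S ≤ c * (length L * length L))))))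
lemma7 = 3 , s≤s z≤n , λ k →
  witness k ,
  stair-binary (suc k) 0 (replicate⁺ (suc k) (inj₂ refl)) ,
  length-witness-≥ k ,
  spine k , spine-∈-CPH-witness k ,
  map suc (upTo (suc k)) ,
  Unique-map⁺ suc-injective (upTo⁺ (suc k)) ,
  spine-children k ,
  subst (λ l → length (witness k) ≤ 3 * (l * l))
        (sym (trans (length-map suc (upTo (suc k))) (length-upTo (suc k))))
        (length-witness-≤ k)
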